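{- For every $N>2$, every integer $\ell$ and every $x$ with $1\le x\le N-1$, $$R(N,\ell,x)=\sum_{i=\max(x,2)}^{N-2} R(N-1,\ell-1,i)+\sum_{i=1}^{\max(x-1,1)} R(N-1,\ell,i).$$
   Context: A recursive tree on $N$ vertices is a tree whose vertices are labeled $0,1,\dots,N-1$, rooted at $0$, such that labels strictly increase along every path from the root. Its smallest rooted path is the path starting at the root that at each vertex proceeds to the child with the smallest label, until it reaches a vertex with no children. $R(N,\ell,x)$ denotes the number of recursive trees on $N$ vertices having exactly $\ell$ vertices of degree $1$ (the root counts if it has degree $1$) and whose smallest rooted path ends at the vertex labeled $x$. -}

module Defs where

open import Data.Nat using (ℕ; zero; suc; _+_; _∸_; _<_; _<?_; _≟_)
open import Data.Integer using (ℤ; +_)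
import Data.Integer as ℤ
open import Data.List using (List; []; _∷_; [_]; map; filter; length; zip; upTo; concatMap)
open import Data.Nat.ListAction using (sum)
open import Data.List.Relation.Unary.All using (All; all?)
open import Data.Product using (_×_; _,_; proj₁; proj₂)
open import Relation.Nullary.Decidable using (Dec; _×-dec_)

-- A recursive tree on N ≥ 1 vertices labelled 0,…,N-1 (rooted at 0, labels
-- increasing along root paths) is encoded by its parent sequence
-- ps = [p₁, …, p_{N-1}], where p_u is the label of the parent of vertex u.
-- Increasing labels along root paths  ⇔  p_u < u for every u.

labelled : List ℕ → List (ℕ × ℕ)
labelled ps = zip (map suc (upTo (length ps))) ps

Valid : List ℕ → Set
Valid ps = All (λ q → proj₂ q < proj₁ q) (labelled ps)

valid? : (ps : List ℕ) → Dec (Valid ps)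
valid? ps = all? (λ q → proj₂ q <? proj₁ q) (labelled ps)

seqs : ℕ → ℕ → List (List ℕ)
seqs zero    m = [ [] ]
seqs (suc k) m = concatMap (λ p → map (p ∷_) (seqs k m)) (upTo m)

RecTrees : ℕ → List (List ℕ)
RecTrees zero    = []
RecTrees (suc n) = filter valid? (seqs n (suc n))

-- Children of v, in increasing order of label.
children : List ℕ → ℕ → List ℕ
children ps v = map proj₁ (filter (λ q → proj₂ q ≟ v) (labelled ps))

deg : List ℕ → ℕ → ℕ
deg ps zero    = length (children ps zero)
deg ps (suc v) = suc (length (children ps (suc v)))

-- Number of vertices of degree 1 among 0,…,N-1 (root included).
leaves : ℕ → List ℕ → ℕ
leaves N ps = length (filter (λ v → deg ps v ≟ 1) (upTo N))

endFrom : ℕ → List ℕ → ℕ → ℕ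
endFrom zero    ps v = v
endFrom (suc f) ps v with children ps v
... | []    = v
... | c ∷ _ = endFrom f ps c

-- Endpoint of the smallest rooted path (the path has < N steps, so fuel N suffices).
spEnd : ℕ → List ℕ → ℕ
spEnd N ps = endFrom N ps 0

R : ℕ → ℤ → ℕ → ℕ
R N ℓ x = length (filter (λ ps → (ℤ._≟_ (+ leaves N ps) ℓ) ×-dec (spEnd N ps ≟ x)) (RecTrees N))

-- Σ_{i=a}^{b} f i  (empty if a > b)
sumRange : ℕ → ℕ → (ℕ → ℕ) → ℕ
sumRange a b f = sum (map (λ j → f (a + j)) (upTo (suc b ∸ a)))

module Submission where

-- A recursive tree on N vertices arises in exactly one way from a recursive tree t on N - 1
-- vertices by attaching vertex N - 1 to some p < N - 1.  This keeps the number of leaves of t if p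
-- is a leaf and raises it by one otherwise, and the smallest rooted path of the new tree ends at
-- N - 1 if p is the end e of that of t, and at e otherwise.  As e is a leaf, this gives for N ≥ 3
-- and x ≠ N - 1 the recurrence R(N,ℓ,x) = (ℓ - 1) R(N-1,ℓ,x) + (N - ℓ) R(N-1,ℓ-1,x), while
-- R(N,ℓ,N-1) is the number of trees on N - 1 vertices with ℓ leaves.  The operator of the
-- recurrence commutes with the difference f ↦ (ℓ ↦ f(ℓ-1) - f(ℓ)) up to the shift N ↦ N + 1, so
-- induction on N yields R(N,ℓ,1) = R(N,ℓ,2) and R(N,ℓ,x) - R(N,ℓ,x+1) = R(N-1,ℓ-1,x) - R(N-1,ℓ,x)
-- for 2 ≤ x ≤ N - 2.  Telescoping these from x up to N - 1 gives the formula.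

open import Defs
open import Data.Bool using (if_then_else_)
open import Data.Empty using (⊥-elim)
open import Data.Integer as ℤ using (ℤ; 1ℤ; _-_) renaming (_+_ to _+ℤ_; _*_ to _*ℤ_)
import Data.Integer.Properties as ℤ
open import Data.Integer.Tactic.RingSolver as ℤ-Solver using ()
open import Data.List using (List; []; _∷_; [_]; _++_; _∷ʳ_; map; filter; length; zip; upTo; applyUpTo; concatMap; cartesianProductWith; initLast; _∷ʳ′_)
open import Data.List.Membership.Propositional using (_∈_)
open import Data.List.Membership.Propositional.Properties
open import Data.List.Membership.Propositional.Properties.WithK using (unique∧set⇒bag)
open import Data.List.Properties using (length-upTo; map-applyUpTo; applyUpTo-∷ʳ; ∷ʳ-injective; ∷-injective; length-++; map-++; filter-++; filter-accept; filter-reject; ++-identityʳ)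
open import Data.List.Relation.Binary.BagAndSetEquality using (∼bag⇒↭)
open import Data.List.Relation.Binary.Permutation.Propositional using (_↭_)
import Data.List.Relation.Binary.Permutation.Propositional.Properties as ↭
open import Data.List.Relation.Unary.All as All using (All; []; _∷_)
import Data.List.Relation.Unary.All.Properties as All
open import Data.List.Relation.Unary.AllPairs using ([]; _∷_)
open import Data.List.Relation.Unary.Any using (here; there)
open import Data.List.Relation.Unary.Unique.Propositional using (Unique)
import Data.List.Relation.Unary.Unique.Propositional.Properties as Unique
open import Data.Nat using (ℕ; zero; suc; _+_; _*_; _∸_; _<_; _≤_; _≟_; _⊔_; z≤n; s≤s; z<s; s<s)
open import Data.Nat.ListAction using (sum)
open import Data.Nat.ListAction.Properties using (sum-↭)
open import Data.Nat.Properties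
open import Algebra.Properties.CommutativeSemigroup +-commutativeSemigroup using () renaming (xy∙z≈xz∙y to +-right-comm; interchange to +-interchange)
open import Data.Product using (_×_; _,_; proj₁; proj₂)
open import Function using (_∘_; id; mk⇔)
open import Relation.Binary.PropositionalEquality hiding ([_])
open import Relation.Nullary using (Dec; yes; no; does; ¬_)
open import Relation.Nullary.Decidable using (_×-dec_; ¬?)

private
  variable
    A B C : Set
    P Q : Set

-- Finite sums and indicators

∑ : List A → (A → ℕ) → ℕ
∑ []       f = 0
∑ (x ∷ xs) f = f x + ∑ xs f

sum-map≡∑ : (xs : List A) (f : A → ℕ) → sum (map f xs) ≡ ∑ xs f
sum-map≡∑ []       f = refl
sum-map≡∑ (x ∷ xs) f = cong (f x +_) (sum-map≡∑ xs f)

∑-cong : (xs : List A) {f g : A → ℕ} → (∀ {x} → x ∈ xs → f x ≡ g x) → ∑ xs f ≡ ∑ xs g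
∑-cong []       eq = refl
∑-cong (x ∷ xs) eq = cong₂ _+_ (eq (here refl)) (∑-cong xs (eq ∘ there))

∑-zero : (xs : List A) → ∑ xs (λ _ → 0) ≡ 0
∑-zero []       = refl
∑-zero (x ∷ xs) = ∑-zero xs

∑-++ : (xs ys : List A) (f : A → ℕ) → ∑ (xs ++ ys) f ≡ ∑ xs f + ∑ ys f
∑-++ []       ys f = refl
∑-++ (x ∷ xs) ys f = trans (cong (f x +_) (∑-++ xs ys f)) (sym (+-assoc (f x) _ _))

∑-map : (g : A → B) (xs : List A) (f : B → ℕ) → ∑ (map g xs) f ≡ ∑ xs (f ∘ g)
∑-map g []       f = refl
∑-map g (x ∷ xs) f = cong (f (g x) +_) (∑-map g xs f)

∑-cartesianProductWith : (g : A → B → C) (xs : List A) (ys : List B) (f : C → ℕ) →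
  ∑ (cartesianProductWith g xs ys) f ≡ ∑ xs (λ x → ∑ ys (f ∘ g x))
∑-cartesianProductWith g []       ys f = refl
∑-cartesianProductWith g (x ∷ xs) ys f = begin
  ∑ (map (g x) ys ++ cartesianProductWith g xs ys) f         ≡⟨ ∑-++ (map (g x) ys) _ f ⟩
  ∑ (map (g x) ys) f + ∑ (cartesianProductWith g xs ys) f   ≡⟨ cong₂ _+_ (∑-map (g x) ys f) (∑-cartesianProductWith g xs ys f) ⟩
  ∑ ys (f ∘ g x) + ∑ xs (λ x → ∑ ys (f ∘ g x))              ∎
  where open ≡-Reasoning

∑-↭ : {xs ys : List A} (f : A → ℕ) → xs ↭ ys → ∑ xs f ≡ ∑ ys f
∑-↭ {xs = xs} {ys} f xs↭ys = begin
  ∑ xs f          ≡⟨ sum-map≡∑ xs f ⟨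
  sum (map f xs)  ≡⟨ sum-↭ (↭.map⁺ f xs↭ys) ⟩
  sum (map f ys)  ≡⟨ sum-map≡∑ ys f ⟩
  ∑ ys f          ∎
  where open ≡-Reasoning

∑-+ : (xs : List A) (f g : A → ℕ) → ∑ xs (λ x → f x + g x) ≡ ∑ xs f + ∑ xs g
∑-+ []       f g = refl
∑-+ (x ∷ xs) f g = trans (cong (f x + g x +_) (∑-+ xs f g)) (+-interchange (f x) (g x) _ _)

∑-*ˡ : (c : ℕ) (xs : List A) (f : A → ℕ) → ∑ xs (λ x → c * f x) ≡ c * ∑ xs f
∑-*ˡ c []       f = sym (*-zeroʳ c)
∑-*ˡ c (x ∷ xs) f = trans (cong (c * f x +_) (∑-*ˡ c xs f)) (sym (*-distribˡ-+ c (f x) _))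

∑-*ʳ : (c : ℕ) (xs : List A) (f : A → ℕ) → ∑ xs (λ x → f x * c) ≡ ∑ xs f * c
∑-*ʳ c xs f = trans (∑-cong xs (λ {x} _ → *-comm (f x) c)) (trans (∑-*ˡ c xs f) (*-comm c _))

∑-swap : (xs : List A) (ys : List B) (f : A → B → ℕ) →
  ∑ xs (λ x → ∑ ys (f x)) ≡ ∑ ys (λ y → ∑ xs (λ x → f x y))
∑-swap xs []       f = ∑-zero xs
∑-swap xs (y ∷ ys) f = trans (∑-+ xs (λ x → f x y) _) (cong (∑ xs (λ x → f x y) +_) (∑-swap xs ys f))

∑-const : (xs : List A) → ∑ xs (λ _ → 1) ≡ length xs
∑-const []       = refl
∑-const (x ∷ xs) = cong suc (∑-const xs)

∑-upTo-∷ʳ : (m : ℕ) (f : ℕ → ℕ) → ∑ (upTo (suc m)) f ≡ ∑ (upTo m) f + f m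
∑-upTo-∷ʳ m f = begin
  ∑ (upTo (suc m)) f       ≡⟨ cong (λ l → ∑ l f) (applyUpTo-∷ʳ id m) ⟨
  ∑ (upTo m ++ [ m ]) f    ≡⟨ ∑-++ (upTo m) [ m ] f ⟩
  ∑ (upTo m) f + (f m + 0) ≡⟨ cong (∑ (upTo m) f +_) (+-identityʳ (f m)) ⟩
  ∑ (upTo m) f + f m       ∎
  where open ≡-Reasoning

∑-upTo-+ : (a b : ℕ) (f : ℕ → ℕ) → ∑ (upTo (a + b)) f ≡ ∑ (upTo a) f + ∑ (upTo b) (λ j → f (a + j))
∑-upTo-+ a zero    f = trans (cong (λ n → ∑ (upTo n) f) (+-identityʳ a)) (sym (+-identityʳ _))
∑-upTo-+ a (suc b) f = begin
  ∑ (upTo (a + suc b)) f                                     ≡⟨ cong (λ n → ∑ (upTo n) f) (+-suc a b) ⟩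
  ∑ (upTo (suc (a + b))) f                                   ≡⟨ ∑-upTo-∷ʳ (a + b) f ⟩
  ∑ (upTo (a + b)) f + f (a + b)                             ≡⟨ cong (_+ f (a + b)) (∑-upTo-+ a b f) ⟩
  ∑ (upTo a) f + ∑ (upTo b) (λ j → f (a + j)) + f (a + b)   ≡⟨ +-assoc (∑ (upTo a) f) _ _ ⟩
  ∑ (upTo a) f + (∑ (upTo b) (λ j → f (a + j)) + f (a + b)) ≡⟨ cong (∑ (upTo a) f +_) (∑-upTo-∷ʳ b (λ j → f (a + j))) ⟨
  ∑ (upTo a) f + ∑ (upTo (suc b)) (λ j → f (a + j))         ∎
  where open ≡-Reasoning

∑-upTo-exchange : (m p : ℕ) {g h : ℕ → ℕ} → p < m → (∀ {v} → v < m → v ≢ p → g v ≡ h v) →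
  ∑ (upTo m) g + h p ≡ ∑ (upTo m) h + g p
∑-upTo-exchange (suc m) p {g} {h} p≤m g≡h with p ≟ m
... | yes refl = begin
  ∑ (upTo (suc p)) g + h p     ≡⟨ cong (_+ h p) (∑-upTo-∷ʳ p g) ⟩
  ∑ (upTo p) g + g p + h p     ≡⟨ cong (λ s → s + g p + h p) (∑-cong (upTo p) (λ v∈ → g≡h (m<n⇒m<1+n (∈-upTo⁻ v∈)) (<⇒≢ (∈-upTo⁻ v∈)))) ⟩
  ∑ (upTo p) h + g p + h p     ≡⟨ +-right-comm (∑ (upTo p) h) (g p) (h p) ⟩
  ∑ (upTo p) h + h p + g p     ≡⟨ cong (_+ g p) (∑-upTo-∷ʳ p h) ⟨
  ∑ (upTo (suc p)) h + g p     ∎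
  where open ≡-Reasoning
... | no p≢m = begin
  ∑ (upTo (suc m)) g + h p     ≡⟨ cong (_+ h p) (∑-upTo-∷ʳ m g) ⟩
  ∑ (upTo m) g + g m + h p     ≡⟨ +-right-comm (∑ (upTo m) g) (g m) (h p) ⟩
  ∑ (upTo m) g + h p + g m     ≡⟨ cong₂ _+_ (∑-upTo-exchange m p (≤∧≢⇒< (≤-pred p≤m) p≢m) (g≡h ∘ m<n⇒m<1+n)) (g≡h ≤-refl (p≢m ∘ sym)) ⟩
  ∑ (upTo m) h + g p + h m     ≡⟨ +-right-comm (∑ (upTo m) h) (g p) (h m) ⟩
  ∑ (upTo m) h + h m + g p     ≡⟨ cong (_+ g p) (∑-upTo-∷ʳ m h) ⟨
  ∑ (upTo (suc m)) h + g p     ∎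
  where open ≡-Reasoning

𝟙 : Dec P → ℕ
𝟙 d = if does d then 1 else 0

𝟙-yes : (d : Dec P) → P → 𝟙 d ≡ 1
𝟙-yes (yes _) _ = refl
𝟙-yes (no ¬p) p = ⊥-elim (¬p p)

𝟙-no : (d : Dec P) → ¬ P → 𝟙 d ≡ 0
𝟙-no (yes p) ¬p = ⊥-elim (¬p p)
𝟙-no (no _)  _  = refl

𝟙+𝟙-¬ : (d : Dec P) → 𝟙 d + 𝟙 (¬? d) ≡ 1
𝟙+𝟙-¬ (yes _) = refl
𝟙+𝟙-¬ (no _)  = refl

𝟙-cong : (d : Dec P) (e : Dec Q) → (P → Q) → (Q → P) → 𝟙 d ≡ 𝟙 e
𝟙-cong (yes p) e P→Q Q→P = sym (𝟙-yes e (P→Q p))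
𝟙-cong (no ¬p) e P→Q Q→P = sym (𝟙-no e (¬p ∘ Q→P))

𝟙-×-dec : (d : Dec P) (e : Dec Q) → 𝟙 (d ×-dec e) ≡ 𝟙 d * 𝟙 e
𝟙-×-dec (yes _) (yes _) = refl
𝟙-×-dec (yes _) (no _)  = refl
𝟙-×-dec (no _)  _       = refl

∑-upTo-𝟙≟ : (m x : ℕ) → x < m → ∑ (upTo m) (λ j → 𝟙 (x ≟ j)) ≡ 1
∑-upTo-𝟙≟ m x x<m = begin
  ∑ (upTo m) (λ j → 𝟙 (x ≟ j))        ≡⟨ +-identityʳ _ ⟨
  ∑ (upTo m) (λ j → 𝟙 (x ≟ j)) + 0    ≡⟨ ∑-upTo-exchange m x x<m (λ _ j≢x → 𝟙-no (x ≟ _) (j≢x ∘ sym)) ⟩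
  ∑ (upTo m) (λ _ → 0) + 𝟙 (x ≟ x)    ≡⟨ cong₂ _+_ (∑-zero (upTo m)) (𝟙-yes (x ≟ x) refl) ⟩
  1                                   ∎
  where open ≡-Reasoning

𝟙-by-cases : (d : Dec P) {k a b : ℕ} → (P → k ≡ a) → (¬ P → k ≡ b) → k ≡ 𝟙 d * a + 𝟙 (¬? d) * b
𝟙-by-cases (yes p) {a = a} k≡a _ = trans (k≡a p) (sym (trans (+-identityʳ (a + 0)) (+-identityʳ a)))
𝟙-by-cases (no ¬p) {b = b} _ k≡b = trans (k≡b ¬p) (sym (+-identityʳ b))

length-filter≡∑𝟙 : {P : A → Set} (P? : ∀ x → Dec (P x)) (xs : List A) → length (filter P? xs) ≡ ∑ xs (𝟙 ∘ P?)
length-filter≡∑𝟙 P? []       = refl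
length-filter≡∑𝟙 P? (x ∷ xs) with P? x
... | yes _ = cong suc (length-filter≡∑𝟙 P? xs)
... | no _  = length-filter≡∑𝟙 P? xs

-- Parent sequences

lab : ℕ → List ℕ → List (ℕ × ℕ)
lab k []       = []
lab k (p ∷ ps) = (k , p) ∷ lab (suc k) ps

zip-applyUpTo≡lab : (ps : List ℕ) (k : ℕ) (f : ℕ → ℕ) → (∀ i → f i ≡ k + i) →
  zip (applyUpTo f (length ps)) ps ≡ lab k ps
zip-applyUpTo≡lab []       k f f≡k+ = refl
zip-applyUpTo≡lab (p ∷ ps) k f f≡k+ = cong₂ _∷_
  (cong (_, p) (trans (f≡k+ 0) (+-identityʳ k)))
  (zip-applyUpTo≡lab ps (suc k) (f ∘ suc) (λ i → trans (f≡k+ (suc i)) (+-suc k i)))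

labelled≡lab : (ps : List ℕ) → labelled ps ≡ lab 1 ps
labelled≡lab ps = trans (cong (λ l → zip l ps) (map-applyUpTo id suc (length ps)))
                        (zip-applyUpTo≡lab ps 1 suc (λ _ → refl))

lab-∷ʳ : (k : ℕ) (ps : List ℕ) (p : ℕ) → lab k (ps ∷ʳ p) ≡ lab k ps ∷ʳ (k + length ps , p)
lab-∷ʳ k []       p = cong (λ c → [ (c , p) ]) (sym (+-identityʳ k))
lab-∷ʳ k (q ∷ ps) p = cong ((k , q) ∷_) (trans (lab-∷ʳ (suc k) ps p) (cong (λ c → lab (suc k) ps ∷ʳ (c , p)) (sym (+-suc k (length ps)))))

lab-labels< : (k : ℕ) (ps : List ℕ) → All (λ q → proj₁ q < k + length ps) (lab k ps)
lab-labels< k []       = []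
lab-labels< k (p ∷ ps) = m<m+n k z<s ∷ All.map (λ {q} → subst (proj₁ q <_) (sym (+-suc k (length ps)))) (lab-labels< (suc k) ps)

map-proj₂-lab : (k : ℕ) (ps : List ℕ) → map proj₂ (lab k ps) ≡ ps
map-proj₂-lab k []       = refl
map-proj₂-lab k (p ∷ ps) = cong (p ∷_) (map-proj₂-lab (suc k) ps)

ParentBelow : ℕ × ℕ → Set
ParentBelow q = proj₂ q < proj₁ q

Valid⇒lab : {ps : List ℕ} → Valid ps → All ParentBelow (lab 1 ps)
Valid⇒lab {ps} = subst (All ParentBelow) (labelled≡lab ps)

lab⇒Valid : {ps : List ℕ} → All ParentBelow (lab 1 ps) → Valid ps
lab⇒Valid {ps} = subst (All ParentBelow) (sym (labelled≡lab ps))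

Valid⇒parents< : {ps : List ℕ} → Valid ps → All (_< suc (length ps)) ps
Valid⇒parents< {ps} valid = subst (All _) (map-proj₂-lab 1 ps)
  (All.map⁺ (All.zipWith (λ (p<c , c<) → <-trans p<c c<) (Valid⇒lab valid , lab-labels< 1 ps)))

Valid-∷ʳ⁺ : {ps : List ℕ} {p : ℕ} → Valid ps → p < suc (length ps) → Valid (ps ∷ʳ p)
Valid-∷ʳ⁺ {ps} {p} valid p< = lab⇒Valid (subst (All ParentBelow) (sym (lab-∷ʳ 1 ps p)) (All.∷ʳ⁺ (Valid⇒lab valid) p<))

Valid-∷ʳ⁻ : {ps : List ℕ} {p : ℕ} → Valid (ps ∷ʳ p) → Valid ps × p < suc (length ps)
Valid-∷ʳ⁻ {ps} {p} valid with All.∷ʳ⁻ (subst (All ParentBelow) (lab-∷ʳ 1 ps p) (Valid⇒lab valid))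
... | valid-ps , p< = lab⇒Valid valid-ps , p<

-- Enumerating recursive trees by their last vertex

concatMap-map≡cartesianProductWith : (f : A → B → C) (xs : List A) (ys : List B) →
  concatMap (λ x → map (f x) ys) xs ≡ cartesianProductWith f xs ys
concatMap-map≡cartesianProductWith f []       ys = refl
concatMap-map≡cartesianProductWith f (x ∷ xs) ys = cong (map (f x) ys ++_) (concatMap-map≡cartesianProductWith f xs ys)

seqs-suc : (k m : ℕ) → seqs (suc k) m ≡ cartesianProductWith _∷_ (upTo m) (seqs k m)
seqs-suc k m = concatMap-map≡cartesianProductWith _∷_ (upTo m) (seqs k m)

∈-seqs⁻ : (k m : ℕ) {xs : List ℕ} → xs ∈ seqs k m → length xs ≡ k × All (_< m) xs
∈-seqs⁻ zero    m (here refl) = refl , []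
∈-seqs⁻ (suc k) m xs∈ with ∈-cartesianProductWith⁻ _∷_ (upTo m) (seqs k m) (subst (_ ∈_) (seqs-suc k m) xs∈)
... | p , ys , p∈ , ys∈ , refl with ∈-seqs⁻ k m ys∈
... | length≡ , ys< = cong suc length≡ , ∈-upTo⁻ p∈ ∷ ys<

∈-seqs⁺ : (k m : ℕ) {xs : List ℕ} → length xs ≡ k → All (_< m) xs → xs ∈ seqs k m
∈-seqs⁺ zero    m {[]}     refl []         = here refl
∈-seqs⁺ (suc k) m {x ∷ xs} length≡ (x< ∷ xs<) = subst (_ ∈_) (sym (seqs-suc k m))
  (∈-cartesianProductWith⁺ _∷_ (∈-upTo⁺ x<) (∈-seqs⁺ k m (suc-injective length≡) xs<))

seqs-unique : (k m : ℕ) → Unique (seqs k m)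
seqs-unique zero    m = [] ∷ []
seqs-unique (suc k) m = subst Unique (sym (seqs-suc k m))
  (Unique.cartesianProductWith⁺ _∷_ ∷-injective (Unique.upTo⁺ m) (seqs-unique k m))

∈-RecTrees⁻ : (n : ℕ) {t : List ℕ} → t ∈ RecTrees (suc n) → length t ≡ n × Valid t
∈-RecTrees⁻ n t∈ with ∈-filter⁻ valid? {xs = seqs n (suc n)} t∈
... | t∈seqs , valid = proj₁ (∈-seqs⁻ n (suc n) t∈seqs) , valid

∈-RecTrees⁺ : (n : ℕ) {t : List ℕ} → length t ≡ n → Valid t → t ∈ RecTrees (suc n)
∈-RecTrees⁺ n {t} refl valid = ∈-filter⁺ valid? (∈-seqs⁺ n (suc n) refl (Valid⇒parents< valid)) valid

RecTrees-unique : (n : ℕ) → Unique (RecTrees n)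
RecTrees-unique zero    = []
RecTrees-unique (suc n) = Unique.filter⁺ valid? (seqs-unique n (suc n))

RecTrees-suc↭ : (n : ℕ) → RecTrees (suc (suc n)) ↭ cartesianProductWith _∷ʳ_ (RecTrees (suc n)) (upTo (suc n))
RecTrees-suc↭ n = ∼bag⇒↭ (unique∧set⇒bag (RecTrees-unique (suc (suc n)))
  (Unique.cartesianProductWith⁺ _∷ʳ_ (λ {ps} {qs} → ∷ʳ-injective ps qs) (RecTrees-unique (suc n)) (Unique.upTo⁺ (suc n)))
  (mk⇔ to from))
  where
  to : {xs : List ℕ} → xs ∈ RecTrees (suc (suc n)) → xs ∈ cartesianProductWith _∷ʳ_ (RecTrees (suc n)) (upTo (suc n))
  to {xs} xs∈ with ∈-RecTrees⁻ (suc n) xs∈ | initLast xs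
  ... | length≡ , valid | t ∷ʳ′ p with Valid-∷ʳ⁻ valid
  ...   | valid-t , p< = ∈-cartesianProductWith⁺ _∷ʳ_
    (∈-RecTrees⁺ n length-t valid-t) (∈-upTo⁺ (subst (λ m → p < suc m) length-t p<))
    where
    length-t : length t ≡ n
    length-t = suc-injective (trans (+-comm 1 (length t)) (trans (sym (length-++ t)) length≡))
  from : {xs : List ℕ} → xs ∈ cartesianProductWith _∷ʳ_ (RecTrees (suc n)) (upTo (suc n)) → xs ∈ RecTrees (suc (suc n))
  from xs∈ with ∈-cartesianProductWith⁻ _∷ʳ_ (RecTrees (suc n)) (upTo (suc n)) xs∈
  ... | t , p , t∈ , p∈ , refl with ∈-RecTrees⁻ n t∈
  ...   | refl , valid = ∈-RecTrees⁺ (suc n) (trans (length-++ t) (+-comm (length t) 1))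
    (Valid-∷ʳ⁺ valid (∈-upTo⁻ p∈))

-- Children, degrees and the smallest rooted path

labelled-∷ʳ : (ps : List ℕ) (p : ℕ) → labelled (ps ∷ʳ p) ≡ labelled ps ∷ʳ (suc (length ps) , p)
labelled-∷ʳ ps p = begin
  labelled (ps ∷ʳ p)                 ≡⟨ labelled≡lab (ps ∷ʳ p) ⟩
  lab 1 (ps ∷ʳ p)                    ≡⟨ lab-∷ʳ 1 ps p ⟩
  lab 1 ps ∷ʳ (suc (length ps) , p)  ≡⟨ cong (_∷ʳ (suc (length ps) , p)) (labelled≡lab ps) ⟨
  labelled ps ∷ʳ (suc (length ps) , p) ∎
  where open ≡-Reasoning

children-∷ʳ : (ps : List ℕ) (p v : ℕ) →
  children (ps ∷ʳ p) v ≡ children ps v ++ map proj₁ (filter (λ q → proj₂ q ≟ v) [ (suc (length ps) , p) ])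
children-∷ʳ ps p v = begin
  map proj₁ (filter (λ q → proj₂ q ≟ v) (labelled (ps ∷ʳ p)))
    ≡⟨ cong (map proj₁ ∘ filter (λ q → proj₂ q ≟ v)) (labelled-∷ʳ ps p) ⟩
  map proj₁ (filter (λ q → proj₂ q ≟ v) (labelled ps ∷ʳ (suc (length ps) , p)))
    ≡⟨ cong (map proj₁) (filter-++ (λ q → proj₂ q ≟ v) (labelled ps) _) ⟩
  map proj₁ (filter (λ q → proj₂ q ≟ v) (labelled ps) ++ filter (λ q → proj₂ q ≟ v) [ (suc (length ps) , p) ])
    ≡⟨ map-++ proj₁ (filter (λ q → proj₂ q ≟ v) (labelled ps)) _ ⟩
  children ps v ++ map proj₁ (filter (λ q → proj₂ q ≟ v) [ (suc (length ps) , p) ]) ∎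
  where open ≡-Reasoning

children-∷ʳ-≡ : (ps : List ℕ) (p : ℕ) → children (ps ∷ʳ p) p ≡ children ps p ∷ʳ suc (length ps)
children-∷ʳ-≡ ps p = trans (children-∷ʳ ps p p)
  (cong (λ l → children ps p ++ map proj₁ l) (filter-accept (λ q → proj₂ q ≟ p) {xs = []} refl))

children-∷ʳ-≢ : (ps : List ℕ) {p v : ℕ} → p ≢ v → children (ps ∷ʳ p) v ≡ children ps v
children-∷ʳ-≢ ps {p} {v} p≢v = trans (children-∷ʳ ps p v)
  (trans (cong (λ l → children ps v ++ map proj₁ l) (filter-reject (λ q → proj₂ q ≟ v) {xs = []} p≢v))
         (++-identityʳ (children ps v)))

deg-children-+ : (ps qs : List ℕ) (v k : ℕ) → length (children qs v) ≡ length (children ps v) + k → deg qs v ≡ deg ps v + k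
deg-children-+ ps qs zero    k eq = eq
deg-children-+ ps qs (suc v) k eq = cong suc eq

deg-∷ʳ-≡ : (ps : List ℕ) (p : ℕ) → deg (ps ∷ʳ p) p ≡ deg ps p + 1
deg-∷ʳ-≡ ps p = deg-children-+ ps (ps ∷ʳ p) p 1 (trans (cong length (children-∷ʳ-≡ ps p)) (length-++ (children ps p)))

deg-∷ʳ-≢ : (ps : List ℕ) {p v : ℕ} → p ≢ v → deg (ps ∷ʳ p) v ≡ deg ps v
deg-∷ʳ-≢ ps {p} {v} p≢v = trans (deg-children-+ ps (ps ∷ʳ p) v 0 (trans (cong length (children-∷ʳ-≢ ps p≢v)) (sym (+-identityʳ _))))
                                  (+-identityʳ (deg ps v))

children-bounds : {t : List ℕ} → Valid t → (v : ℕ) → All (λ c → v < c × c < suc (length t)) (children t v)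
children-bounds {t} valid v = All.map⁺ (All.zipWith (λ ((p<c , c<) , p≡v) → subst (_< _) p≡v p<c , c<)
  (All.filter⁺ (λ q → proj₂ q ≟ v) (All.zipWith id (valid , subst (All _) (sym (labelled≡lab t)) (lab-labels< 1 t))) ,
   All.all-filter (λ q → proj₂ q ≟ v) (labelled t)))

endFrom-leaf : (f : ℕ) (ps : List ℕ) {v : ℕ} → children ps v ≡ [] → endFrom f ps v ≡ v
endFrom-leaf zero    ps eq = refl
endFrom-leaf (suc f) ps eq rewrite eq = refl

endFrom-child : (f : ℕ) (ps : List ℕ) {v c : ℕ} {cs : List ℕ} → children ps v ≡ c ∷ cs → endFrom (suc f) ps v ≡ endFrom f ps c
endFrom-child f ps eq rewrite eq = refl

data ChildrenView (t : List ℕ) (v : ℕ) : Set where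
  leaf  : children t v ≡ [] → ChildrenView t v
  inner : (c : ℕ) (cs : List ℕ) → children t v ≡ c ∷ cs → v < c → c ≤ length t → ChildrenView t v

childrenView : {t : List ℕ} → Valid t → (v : ℕ) → ChildrenView t v
childrenView {t} valid v with children t v in eq
... | []     = leaf eq
... | c ∷ cs with subst (All _) eq (children-bounds valid v)
...   | (v<c , c<) ∷ _ = inner c cs eq v<c (≤-pred c<)

≤-+suc-step : {m v c : ℕ} (f : ℕ) → m ≤ v + suc f → v < c → m ≤ c + f
≤-+suc-step {v = v} {c} f m≤ v<c = ≤-trans m≤ (subst (_≤ c + f) (sym (+-suc v f)) (+-monoˡ-≤ f v<c))

endFrom-∷ʳ-child : (f : ℕ) (ps : List ℕ) (p : ℕ) {v c : ℕ} {cs : List ℕ} → children ps v ≡ c ∷ cs →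
  endFrom (suc f) (ps ∷ʳ p) v ≡ endFrom f (ps ∷ʳ p) c
endFrom-∷ʳ-child f ps p {v} eq = endFrom-child f (ps ∷ʳ p) (trans (children-∷ʳ ps p v) (cong (_++ map proj₁ (filter (λ q → proj₂ q ≟ v) [ (suc (length ps) , p) ])) eq))

root-has-child : {t : List ℕ} → Valid t → 1 ≤ length t → children t 0 ≢ []
root-has-child {q ∷ _} (z<s ∷ _) _ = λ ()

module _ {t : List ℕ} (valid : Valid t) where

  children-≥ : {v : ℕ} → length t ≤ v → children t v ≡ []
  children-≥ {v} t≤v with childrenView valid v
  ... | leaf eq              = eq
  ... | inner c cs _ v<c c≤ = ⊥-elim (<⇒≱ (<-≤-trans v<c c≤) t≤v)

  -- Labels increase along the path, so length t ∸ v steps of fuel reach a leaf.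
  endFrom-isLeaf : (f v : ℕ) → length t ≤ v + f → children t (endFrom f t v) ≡ []
  endFrom-isLeaf zero    v t≤ = children-≥ (subst (length t ≤_) (+-identityʳ v) t≤)
  endFrom-isLeaf (suc f) v t≤ with childrenView valid v
  ... | leaf eq              = trans (cong (children t) (endFrom-leaf (suc f) t eq)) eq
  ... | inner c cs eq v<c _ = trans (cong (children t) (endFrom-child f t eq)) (endFrom-isLeaf f c (≤-+suc-step f t≤ v<c))

  endFrom≤ : (f v : ℕ) → v ≤ length t → endFrom f t v ≤ length t
  endFrom≤ zero    v v≤ = v≤
  endFrom≤ (suc f) v v≤ with childrenView valid v
  ... | leaf eq             = subst (_≤ length t) (sym (endFrom-leaf (suc f) t eq)) v≤
  ... | inner c cs eq _ c≤ = subst (_≤ length t) (sym (endFrom-child f t eq)) (endFrom≤ f c c≤)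

  deg≥1 : 1 ≤ length t → (v : ℕ) → 1 ≤ deg t v
  deg≥1 t≥1 zero with childrenView valid 0
  ... | leaf eq             = ⊥-elim (root-has-child valid t≥1 eq)
  ... | inner c cs eq _ _  = subst (λ l → 1 ≤ length l) (sym eq) (s≤s z≤n)
  deg≥1 t≥1 (suc v) = s≤s z≤n

  spEnd-isLeaf : children t (spEnd (suc (length t)) t) ≡ []
  spEnd-isLeaf = endFrom-isLeaf (suc (length t)) 0 (n≤1+n (length t))

  spEnd≤ : spEnd (suc (length t)) t ≤ length t
  spEnd≤ = endFrom≤ (suc (length t)) 0 z≤n

  spEnd≢0 : 1 ≤ length t → spEnd (suc (length t)) t ≢ 0
  spEnd≢0 t≥1 e≡0 = root-has-child valid t≥1 (subst (λ v → children t v ≡ []) e≡0 spEnd-isLeaf)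

  deg-spEnd : 1 ≤ length t → deg t (spEnd (suc (length t)) t) ≡ 1
  deg-spEnd t≥1 with spEnd (suc (length t)) t | spEnd-isLeaf | spEnd≢0 t≥1
  ... | zero  | _       | e≢0 = ⊥-elim (e≢0 refl)
  ... | suc e | isLeaf  | _   = cong (suc ∘ length) isLeaf

  module _ {p : ℕ} (p< : p < suc (length t)) where

    newVertex-isLeaf : children (t ∷ʳ p) (suc (length t)) ≡ []
    newVertex-isLeaf = trans (children-∷ʳ-≢ t (<⇒≢ p<)) (children-≥ (n≤1+n _))

    endFrom-∷ʳ-≢ : (f v : ℕ) → length t ≤ v + f → endFrom f t v ≢ p → endFrom (suc f) (t ∷ʳ p) v ≡ endFrom f t v
    endFrom-∷ʳ-≢ f v t≤ end≢p with childrenView valid v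
    ... | leaf eq = begin
      endFrom (suc f) (t ∷ʳ p) v  ≡⟨ endFrom-leaf (suc f) (t ∷ʳ p) (trans (children-∷ʳ-≢ t p≢v) eq) ⟩
      v                           ≡⟨ endFrom-leaf f t eq ⟨
      endFrom f t v               ∎
      where
      open ≡-Reasoning
      p≢v : p ≢ v
      p≢v p≡v = end≢p (trans (endFrom-leaf f t eq) (sym p≡v))
    endFrom-∷ʳ-≢ zero    v t≤ _     | inner c cs eq v<c c≤ = ⊥-elim (<⇒≱ (<-≤-trans v<c c≤) (subst (length t ≤_) (+-identityʳ v) t≤))
    endFrom-∷ʳ-≢ (suc f) v t≤ end≢p | inner c cs eq v<c _ = begin
      endFrom (suc (suc f)) (t ∷ʳ p) v ≡⟨ endFrom-∷ʳ-child (suc f) t p eq ⟩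
      endFrom (suc f) (t ∷ʳ p) c       ≡⟨ endFrom-∷ʳ-≢ f c (≤-+suc-step f t≤ v<c) (end≢p ∘ trans (endFrom-child f t eq)) ⟩
      endFrom f t c                    ≡⟨ endFrom-child f t eq ⟨
      endFrom (suc f) t v              ∎
      where open ≡-Reasoning

    endFrom-∷ʳ-≡ : (f v : ℕ) → length t ≤ v + f → endFrom f t v ≡ p → endFrom (suc f) (t ∷ʳ p) v ≡ suc (length t)
    endFrom-∷ʳ-≡ f v t≤ end≡p with childrenView valid v
    ... | leaf eq with refl ← trans (sym (endFrom-leaf f t eq)) end≡p = begin
      endFrom (suc f) (t ∷ʳ v) v                 ≡⟨ endFrom-child f (t ∷ʳ v) (trans (children-∷ʳ-≡ t v) (cong (_∷ʳ suc (length t)) eq)) ⟩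
      endFrom f (t ∷ʳ v) (suc (length t))        ≡⟨ endFrom-leaf f (t ∷ʳ v) newVertex-isLeaf ⟩
      suc (length t)                             ∎
      where open ≡-Reasoning
    endFrom-∷ʳ-≡ zero    v t≤ _     | inner c cs eq v<c c≤ = ⊥-elim (<⇒≱ (<-≤-trans v<c c≤) (subst (length t ≤_) (+-identityʳ v) t≤))
    endFrom-∷ʳ-≡ (suc f) v t≤ end≡p | inner c cs eq v<c _ =
      trans (endFrom-∷ʳ-child (suc f) t p eq) (endFrom-∷ʳ-≡ f c (≤-+suc-step f t≤ v<c) (trans (sym (endFrom-child f t eq)) end≡p))

    spEnd-∷ʳ-≢ : p ≢ spEnd (suc (length t)) t → spEnd (suc (suc (length t))) (t ∷ʳ p) ≡ spEnd (suc (length t)) t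
    spEnd-∷ʳ-≢ p≢e = endFrom-∷ʳ-≢ (suc (length t)) 0 (n≤1+n _) (p≢e ∘ sym)

    spEnd-∷ʳ-≡ : p ≡ spEnd (suc (length t)) t → spEnd (suc (suc (length t))) (t ∷ʳ p) ≡ suc (length t)
    spEnd-∷ʳ-≡ p≡e = endFrom-∷ʳ-≡ (suc (length t)) 0 (n≤1+n _) (sym p≡e)

    leaves-∷ʳ : 1 ≤ length t → leaves (suc (suc (length t))) (t ∷ʳ p) + 𝟙 (deg t p ≟ 1) ≡ leaves (suc (length t)) t + 1
    leaves-∷ʳ t≥1 = begin
      leaves (suc (suc n)) (t ∷ʳ p) + h p  ≡⟨ cong (_+ h p) (length-filter≡∑𝟙 (λ v → deg (t ∷ʳ p) v ≟ 1) (upTo (suc (suc n)))) ⟩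
      ∑ (upTo (suc (suc n))) g + h p       ≡⟨ cong (_+ h p) (∑-upTo-∷ʳ (suc n) g) ⟩
      ∑ (upTo (suc n)) g + g (suc n) + h p ≡⟨ +-right-comm (∑ (upTo (suc n)) g) (g (suc n)) (h p) ⟩
      ∑ (upTo (suc n)) g + h p + g (suc n) ≡⟨ cong₂ _+_ (∑-upTo-exchange (suc n) p p< (λ _ v≢p → g≡h (v≢p ∘ sym))) g-new ⟩
      ∑ (upTo (suc n)) h + g p + 1         ≡⟨ cong (λ k → ∑ (upTo (suc n)) h + k + 1) g-p ⟩
      ∑ (upTo (suc n)) h + 0 + 1           ≡⟨ cong (_+ 1) (+-identityʳ _) ⟩
      ∑ (upTo (suc n)) h + 1               ≡⟨ cong (_+ 1) (length-filter≡∑𝟙 (λ v → deg t v ≟ 1) (upTo (suc n))) ⟨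
      leaves (suc n) t + 1                 ∎
      where
      open ≡-Reasoning
      n : ℕ
      n = length t
      g h : ℕ → ℕ
      g v = 𝟙 (deg (t ∷ʳ p) v ≟ 1)
      h v = 𝟙 (deg t v ≟ 1)
      g≡h : {v : ℕ} → p ≢ v → g v ≡ h v
      g≡h p≢v = cong (λ d → 𝟙 (d ≟ 1)) (deg-∷ʳ-≢ t p≢v)
      g-new : g (suc n) ≡ 1
      g-new = 𝟙-yes (deg (t ∷ʳ p) (suc n) ≟ 1) (cong (suc ∘ length) newVertex-isLeaf)
      g-p : g p ≡ 0
      g-p = 𝟙-no (deg (t ∷ʳ p) p ≟ 1) λ deg≡1 → <⇒≢ (+-monoˡ-≤ 1 (deg≥1 t≥1 p)) (sym (trans (sym (deg-∷ʳ-≡ t p)) deg≡1))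

-- The recurrence in N

-- Of the N - 1 ways to attach vertex N - 1 to a tree with ℓ leaves, ℓ - 1 keep ℓ leaves and the
-- end (attaching to a leaf other than the end); of those to a tree with ℓ - 1 leaves, N - ℓ reach
-- ℓ leaves (attaching to an inner vertex).
attach : ℕ → (ℤ → ℤ) → ℤ → ℤ
attach N f ℓ = (ℓ - 1ℤ) *ℤ f ℓ +ℤ (ℤ.+ N - ℓ) *ℤ f (ℓ - 1ℤ)

Δ : (ℤ → ℤ) → ℤ → ℤ
Δ f ℓ = f (ℓ - 1ℤ) - f ℓ

module _ (N : ℕ) where

  attach-cong : {f g : ℤ → ℤ} → (∀ l → f l ≡ g l) → (ℓ : ℤ) → attach N f ℓ ≡ attach N g ℓ
  attach-cong f≡g ℓ = cong₂ (λ a b → (ℓ - 1ℤ) *ℤ a +ℤ (ℤ.+ N - ℓ) *ℤ b) (f≡g ℓ) (f≡g (ℓ - 1ℤ))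

  attach-+ : (f g : ℤ → ℤ) (ℓ : ℤ) → attach N f ℓ +ℤ attach N g ℓ ≡ attach N (λ l → f l +ℤ g l) ℓ
  attach-+ f g ℓ = solve ℓ (ℤ.+ N) (f ℓ) (f (ℓ - 1ℤ)) (g ℓ) (g (ℓ - 1ℤ))
    where
    solve : ∀ l M a b c d → (l - 1ℤ) *ℤ a +ℤ (M - l) *ℤ b +ℤ ((l - 1ℤ) *ℤ c +ℤ (M - l) *ℤ d)
                         ≡ (l - 1ℤ) *ℤ (a +ℤ c) +ℤ (M - l) *ℤ (b +ℤ d)
    solve = ℤ-Solver.solve-∀

  attach-- : (f g : ℤ → ℤ) (ℓ : ℤ) → attach N f ℓ - attach N g ℓ ≡ attach N (λ l → f l - g l) ℓ
  attach-- f g ℓ = solve ℓ (ℤ.+ N) (f ℓ) (f (ℓ - 1ℤ)) (g ℓ) (g (ℓ - 1ℤ))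
    where
    solve : ∀ l M a b c d → (l - 1ℤ) *ℤ a +ℤ (M - l) *ℤ b - ((l - 1ℤ) *ℤ c +ℤ (M - l) *ℤ d)
                         ≡ (l - 1ℤ) *ℤ (a - c) +ℤ (M - l) *ℤ (b - d)
    solve = ℤ-Solver.solve-∀

  attach-*ʳ : (f : ℤ → ℤ) (c ℓ : ℤ) → attach N f ℓ *ℤ c ≡ attach N (λ l → f l *ℤ c) ℓ
  attach-*ʳ f c ℓ = solve ℓ (ℤ.+ N) (f ℓ) (f (ℓ - 1ℤ)) c
    where
    solve : ∀ l M a b c → ((l - 1ℤ) *ℤ a +ℤ (M - l) *ℤ b) *ℤ c ≡ (l - 1ℤ) *ℤ (a *ℤ c) +ℤ (M - l) *ℤ (b *ℤ c)
    solve = ℤ-Solver.solve-∀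

  attach-suc : (f : ℤ → ℤ) (ℓ : ℤ) → attach (suc N) f ℓ ≡ attach N f ℓ +ℤ f (ℓ - 1ℤ)
  attach-suc f ℓ = solve ℓ (ℤ.+ N) (f ℓ) (f (ℓ - 1ℤ))
    where
    solve : ∀ l M a b → (l - 1ℤ) *ℤ a +ℤ ((1ℤ +ℤ M) - l) *ℤ b ≡ (l - 1ℤ) *ℤ a +ℤ (M - l) *ℤ b +ℤ b
    solve = ℤ-Solver.solve-∀

  attach-Δ : (f : ℤ → ℤ) (ℓ : ℤ) → attach (suc N) (Δ f) ℓ ≡ Δ (attach N f) ℓ
  attach-Δ f ℓ = solve ℓ (ℤ.+ N) (f ℓ) (f (ℓ - 1ℤ)) (f (ℓ - 1ℤ - 1ℤ))
    where
    solve : ∀ l M a b c → (l - 1ℤ) *ℤ (b - a) +ℤ ((1ℤ +ℤ M) - l) *ℤ (c - b)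
                        ≡ ((l - 1ℤ) - 1ℤ) *ℤ b +ℤ (M - (l - 1ℤ)) *ℤ c - ((l - 1ℤ) *ℤ a +ℤ (M - l) *ℤ b)
    solve = ℤ-Solver.solve-∀

  attach-∑ : (xs : List A) {f : A → ℕ} {g : ℤ → A → ℕ} (ℓ : ℤ) →
    (∀ {a} → a ∈ xs → ℤ.+ f a ≡ attach N (λ l → ℤ.+ g l a) ℓ) →
    ℤ.+ ∑ xs f ≡ attach N (λ l → ℤ.+ ∑ xs (g l)) ℓ
  attach-∑ []       ℓ _  = solve ℓ (ℤ.+ N)
    where
    solve : ∀ l M → ℤ.+ 0 ≡ (l - 1ℤ) *ℤ ℤ.+ 0 +ℤ (M - l) *ℤ ℤ.+ 0
    solve = ℤ-Solver.solve-∀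
  attach-∑ (a ∷ xs) {f} {g} ℓ f≡ = begin
    ℤ.+ (f a + ∑ xs f)                                                   ≡⟨ ℤ.pos-+ (f a) (∑ xs f) ⟩
    ℤ.+ f a +ℤ ℤ.+ ∑ xs f                                                ≡⟨ cong₂ _+ℤ_ (f≡ (here refl)) (attach-∑ xs {f} {g} ℓ (f≡ ∘ there)) ⟩
    attach N (λ l → ℤ.+ g l a) ℓ +ℤ attach N (λ l → ℤ.+ ∑ xs (g l)) ℓ    ≡⟨ attach-+ (λ l → ℤ.+ g l a) (λ l → ℤ.+ ∑ xs (g l)) ℓ ⟩
    attach N (λ l → ℤ.+ g l a +ℤ ℤ.+ ∑ xs (g l)) ℓ                       ≡⟨ attach-cong (λ l → ℤ.pos-+ (g l a) (∑ xs (g l))) ℓ ⟨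
    attach N (λ l → ℤ.+ ∑ (a ∷ xs) (g l)) ℓ                              ∎
    where open ≡-Reasoning

𝟙-subst : (F : ℤ → ℤ) {a b : ℤ} (d : Dec (a ≡ b)) → F a *ℤ ℤ.+ 𝟙 d ≡ F b *ℤ ℤ.+ 𝟙 d
𝟙-subst F (yes refl) = refl
𝟙-subst F {a} {b} (no _) = trans (ℤ.*-zeroʳ (F a)) (sym (ℤ.*-zeroʳ (F b)))

𝟙-suc≟ : (m : ℕ) (ℓ : ℤ) → 𝟙 (ℤ.+ suc m ℤ.≟ ℓ) ≡ 𝟙 (ℤ.+ m ℤ.≟ ℓ - 1ℤ)
𝟙-suc≟ m ℓ = 𝟙-cong (ℤ.+ suc m ℤ.≟ ℓ) (ℤ.+ m ℤ.≟ ℓ - 1ℤ)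
  (λ { refl → solve (ℤ.+ m) })
  (λ eq → trans (cong (1ℤ +ℤ_) eq) (solve′ ℓ))
  where
  solve : ∀ x → x ≡ 1ℤ +ℤ x - 1ℤ
  solve = ℤ-Solver.solve-∀
  solve′ : ∀ x → 1ℤ +ℤ (x - 1ℤ) ≡ x
  solve′ = ℤ-Solver.solve-∀

m+n≡o⇒+m≡+o-+n : {m n o : ℕ} → m + n ≡ o → ℤ.+ m ≡ ℤ.+ o - ℤ.+ n
m+n≡o⇒+m≡+o-+n {m} {n} refl = trans (solve (ℤ.+ m) (ℤ.+ n)) (cong (_- ℤ.+ n) (sym (ℤ.pos-+ m n)))
  where
  solve : ∀ x y → x ≡ x +ℤ y - y
  solve = ℤ-Solver.solve-∀

counted : ℕ → ℤ → ℕ → List ℕ → ℕ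
counted N ℓ x ps = 𝟙 ((ℤ.+ leaves N ps ℤ.≟ ℓ) ×-dec (spEnd N ps ≟ x))

R≡∑counted : (N : ℕ) (ℓ : ℤ) (x : ℕ) → R N ℓ x ≡ ∑ (RecTrees N) (counted N ℓ x)
R≡∑counted N ℓ x = length-filter≡∑𝟙 (λ ps → (ℤ.+ leaves N ps ℤ.≟ ℓ) ×-dec (spEnd N ps ≟ x)) (RecTrees N)

module Attaching {t : List ℕ} (valid : Valid t) (t≥1 : 1 ≤ length t) where

  n L e : ℕ
  n = length t
  L = leaves (suc n) t
  e = spEnd (suc n) t

  leaves-∷ʳ-leaf : {p : ℕ} → p < suc n → deg t p ≡ 1 → leaves (suc (suc n)) (t ∷ʳ p) ≡ L
  leaves-∷ʳ-leaf {p} p< deg≡1 = +-cancelʳ-≡ _ _ _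
    (trans (cong (leaves (suc (suc n)) (t ∷ʳ p) +_) (sym (𝟙-yes (deg t p ≟ 1) deg≡1))) (leaves-∷ʳ valid p< t≥1))

  leaves-∷ʳ-inner : {p : ℕ} → p < suc n → deg t p ≢ 1 → leaves (suc (suc n)) (t ∷ʳ p) ≡ suc L
  leaves-∷ʳ-inner {p} p< deg≢1 = begin
    leaves (suc (suc n)) (t ∷ʳ p)                        ≡⟨ +-identityʳ _ ⟨
    leaves (suc (suc n)) (t ∷ʳ p) + 0                    ≡⟨ cong (leaves (suc (suc n)) (t ∷ʳ p) +_) (𝟙-no (deg t p ≟ 1) deg≢1) ⟨
    leaves (suc (suc n)) (t ∷ʳ p) + 𝟙 (deg t p ≟ 1)      ≡⟨ leaves-∷ʳ valid p< t≥1 ⟩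
    L + 1                                               ≡⟨ +-comm L 1 ⟩
    suc L                                               ∎
    where open ≡-Reasoning

  leafIndicator-∷ʳ : (ℓ : ℤ) {p : ℕ} → p < suc n →
    𝟙 (ℤ.+ leaves (suc (suc n)) (t ∷ʳ p) ℤ.≟ ℓ) ≡ 𝟙 (deg t p ≟ 1) * 𝟙 (ℤ.+ L ℤ.≟ ℓ) + 𝟙 (¬? (deg t p ≟ 1)) * 𝟙 (ℤ.+ suc L ℤ.≟ ℓ)
  leafIndicator-∷ʳ ℓ {p} p< = 𝟙-by-cases (deg t p ≟ 1)
    (λ deg≡1 → cong (λ k → 𝟙 (ℤ.+ k ℤ.≟ ℓ)) (leaves-∷ʳ-leaf p< deg≡1))
    (λ deg≢1 → cong (λ k → 𝟙 (ℤ.+ k ℤ.≟ ℓ)) (leaves-∷ʳ-inner p< deg≢1))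

  leaves+inner : L + ∑ (upTo (suc n)) (λ v → 𝟙 (¬? (deg t v ≟ 1))) ≡ suc n
  leaves+inner = begin
    L + ∑ (upTo (suc n)) isInner                            ≡⟨ cong (_+ ∑ (upTo (suc n)) isInner) (length-filter≡∑𝟙 (λ v → deg t v ≟ 1) (upTo (suc n))) ⟩
    ∑ (upTo (suc n)) isLeaf + ∑ (upTo (suc n)) isInner      ≡⟨ ∑-+ (upTo (suc n)) isLeaf isInner ⟨
    ∑ (upTo (suc n)) (λ v → isLeaf v + isInner v)          ≡⟨ ∑-cong (upTo (suc n)) (λ {v} _ → 𝟙+𝟙-¬ (deg t v ≟ 1)) ⟩
    ∑ (upTo (suc n)) (λ _ → 1)                             ≡⟨ trans (∑-const (upTo (suc n))) (length-upTo (suc n)) ⟩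
    suc n                                                  ∎
    where
    open ≡-Reasoning
    isLeaf isInner : ℕ → ℕ
    isLeaf v = 𝟙 (deg t v ≟ 1)
    isInner v = 𝟙 (¬? (deg t v ≟ 1))

  leafCount-∷ʳ : (ℓ : ℤ) → ℤ.+ ∑ (upTo (suc n)) (λ p → 𝟙 (ℤ.+ leaves (suc (suc n)) (t ∷ʳ p) ℤ.≟ ℓ))
                         ≡ ℓ *ℤ ℤ.+ 𝟙 (ℤ.+ L ℤ.≟ ℓ) +ℤ (ℤ.+ suc (suc n) - ℓ) *ℤ ℤ.+ 𝟙 (ℤ.+ L ℤ.≟ ℓ - 1ℤ)
  leafCount-∷ʳ ℓ = begin
    ℤ.+ ∑ (upTo (suc n)) (λ p → 𝟙 (ℤ.+ leaves (suc (suc n)) (t ∷ʳ p) ℤ.≟ ℓ))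
      ≡⟨ cong ℤ.+_ (∑-cong (upTo (suc n)) (leafIndicator-∷ʳ ℓ ∘ ∈-upTo⁻)) ⟩
    ℤ.+ ∑ (upTo (suc n)) (λ p → isLeaf p * a + isInner p * b)
      ≡⟨ cong ℤ.+_ (trans (∑-+ (upTo (suc n)) (λ p → isLeaf p * a) (λ p → isInner p * b)) (cong₂ _+_ (∑-*ʳ a (upTo (suc n)) isLeaf) (∑-*ʳ b (upTo (suc n)) isInner))) ⟩
    ℤ.+ (∑ (upTo (suc n)) isLeaf * a + innerCount * b)
      ≡⟨ cong (λ k → ℤ.+ (k * a + innerCount * b)) (length-filter≡∑𝟙 (λ v → deg t v ≟ 1) (upTo (suc n))) ⟨
    ℤ.+ (L * a + innerCount * b)
      ≡⟨ trans (ℤ.pos-+ (L * a) (innerCount * b)) (cong₂ _+ℤ_ (ℤ.pos-* L a) (ℤ.pos-* innerCount b)) ⟩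
    ℤ.+ L *ℤ ℤ.+ a +ℤ ℤ.+ innerCount *ℤ ℤ.+ b
      ≡⟨ cong₂ _+ℤ_ (𝟙-subst id (ℤ.+ L ℤ.≟ ℓ)) (cong (_*ℤ ℤ.+ b) (m+n≡o⇒+m≡+o-+n {innerCount} {suc L} (trans (+-comm innerCount (suc L)) (cong suc leaves+inner)))) ⟩
    ℓ *ℤ ℤ.+ a +ℤ (ℤ.+ suc (suc n) - ℤ.+ suc L) *ℤ ℤ.+ b
      ≡⟨ cong (ℓ *ℤ ℤ.+ a +ℤ_) (𝟙-subst (ℤ.+ suc (suc n) -_) (ℤ.+ suc L ℤ.≟ ℓ)) ⟩
    ℓ *ℤ ℤ.+ a +ℤ (ℤ.+ suc (suc n) - ℓ) *ℤ ℤ.+ b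
      ≡⟨ cong (λ k → ℓ *ℤ ℤ.+ a +ℤ (ℤ.+ suc (suc n) - ℓ) *ℤ ℤ.+ k) (𝟙-suc≟ L ℓ) ⟩
    ℓ *ℤ ℤ.+ a +ℤ (ℤ.+ suc (suc n) - ℓ) *ℤ ℤ.+ 𝟙 (ℤ.+ L ℤ.≟ ℓ - 1ℤ) ∎
    where
    open ≡-Reasoning
    a b innerCount : ℕ
    a = 𝟙 (ℤ.+ L ℤ.≟ ℓ)
    b = 𝟙 (ℤ.+ suc L ℤ.≟ ℓ)
    isLeaf isInner : ℕ → ℕ
    isLeaf v = 𝟙 (deg t v ≟ 1)
    isInner v = 𝟙 (¬? (deg t v ≟ 1))
    innerCount = ∑ (upTo (suc n)) isInner

  e<suc-n : e < suc n
  e<suc-n = s≤s (spEnd≤ valid)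

  counted-∷ʳ-≢e : (ℓ : ℤ) (x : ℕ) {p : ℕ} → p < suc n → p ≢ e →
    counted (suc (suc n)) ℓ x (t ∷ʳ p) ≡ 𝟙 (ℤ.+ leaves (suc (suc n)) (t ∷ʳ p) ℤ.≟ ℓ) * 𝟙 (e ≟ x)
  counted-∷ʳ-≢e ℓ x {p} p< p≢e = trans (𝟙-×-dec (ℤ.+ leaves (suc (suc n)) (t ∷ʳ p) ℤ.≟ ℓ) (spEnd (suc (suc n)) (t ∷ʳ p) ≟ x))
    (cong (λ y → 𝟙 (ℤ.+ leaves (suc (suc n)) (t ∷ʳ p) ℤ.≟ ℓ) * 𝟙 (y ≟ x)) (spEnd-∷ʳ-≢ valid p< p≢e))

  counted-∷ʳ-e : (ℓ : ℤ) (x : ℕ) → counted (suc (suc n)) ℓ x (t ∷ʳ e) ≡ 𝟙 (ℤ.+ L ℤ.≟ ℓ) * 𝟙 (suc n ≟ x)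
  counted-∷ʳ-e ℓ x = trans (𝟙-×-dec (ℤ.+ leaves (suc (suc n)) (t ∷ʳ e) ℤ.≟ ℓ) (spEnd (suc (suc n)) (t ∷ʳ e) ≟ x))
    (cong₂ (λ k y → 𝟙 (ℤ.+ k ℤ.≟ ℓ) * 𝟙 (y ≟ x)) (leaves-∷ʳ-leaf e<suc-n (deg-spEnd valid t≥1)) (spEnd-∷ʳ-≡ valid e<suc-n refl))

  counted-∷ʳ : (ℓ : ℤ) {x : ℕ} → x ≢ suc n →
    ℤ.+ ∑ (upTo (suc n)) (λ p → counted (suc (suc n)) ℓ x (t ∷ʳ p)) ≡ attach (suc (suc n)) (λ l → ℤ.+ counted (suc n) l x t) ℓ
  counted-∷ʳ ℓ {x} x≢ = begin
    ℤ.+ ∑ (upTo (suc n)) term                                                    ≡⟨ m+n≡o⇒+m≡+o-+n countℕ ⟩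
    ℤ.+ (∑ (upTo (suc n)) leafAt * X) - ℤ.+ (a * X)                             ≡⟨ cong₂ _-_ (ℤ.pos-* (∑ (upTo (suc n)) leafAt) X) (ℤ.pos-* a X) ⟩
    ℤ.+ ∑ (upTo (suc n)) leafAt *ℤ ℤ.+ X - ℤ.+ a *ℤ ℤ.+ X                       ≡⟨ cong (λ k → k *ℤ ℤ.+ X - ℤ.+ a *ℤ ℤ.+ X) (leafCount-∷ʳ ℓ) ⟩
    (ℓ *ℤ ℤ.+ a +ℤ (ℤ.+ N - ℓ) *ℤ ℤ.+ b) *ℤ ℤ.+ X - ℤ.+ a *ℤ ℤ.+ X          ≡⟨ solve ℓ (ℤ.+ N) (ℤ.+ a) (ℤ.+ b) (ℤ.+ X) ⟩
    attach N (λ l → ℤ.+ 𝟙 (ℤ.+ L ℤ.≟ l)) ℓ *ℤ ℤ.+ X                              ≡⟨ attach-*ʳ N (λ l → ℤ.+ 𝟙 (ℤ.+ L ℤ.≟ l)) (ℤ.+ X) ℓ ⟩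
    attach N (λ l → ℤ.+ 𝟙 (ℤ.+ L ℤ.≟ l) *ℤ ℤ.+ X) ℓ                              ≡⟨ attach-cong N (λ l → trans (sym (ℤ.pos-* (𝟙 (ℤ.+ L ℤ.≟ l)) X)) (cong ℤ.+_ (sym (𝟙-×-dec (ℤ.+ L ℤ.≟ l) (e ≟ x))))) ℓ ⟩
    attach N (λ l → ℤ.+ counted (suc n) l x t) ℓ                                 ∎
    where
    open ≡-Reasoning
    N : ℕ
    N = suc (suc n)
    term leafAt : ℕ → ℕ
    term p = counted N ℓ x (t ∷ʳ p)
    leafAt p = 𝟙 (ℤ.+ leaves N (t ∷ʳ p) ℤ.≟ ℓ)
    X a b : ℕ
    X = 𝟙 (e ≟ x)
    a = 𝟙 (ℤ.+ L ℤ.≟ ℓ)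
    b = 𝟙 (ℤ.+ L ℤ.≟ ℓ - 1ℤ)
    -- Attaching to e is the one choice that moves the end away from e.
    countℕ : ∑ (upTo (suc n)) term + a * X ≡ ∑ (upTo (suc n)) leafAt * X
    countℕ = begin
      ∑ (upTo (suc n)) term + a * X                    ≡⟨ cong (λ k → ∑ (upTo (suc n)) term + k * X) (cong (λ k → 𝟙 (ℤ.+ k ℤ.≟ ℓ)) (leaves-∷ʳ-leaf e<suc-n (deg-spEnd valid t≥1))) ⟨
      ∑ (upTo (suc n)) term + leafAt e * X             ≡⟨ ∑-upTo-exchange (suc n) e e<suc-n (counted-∷ʳ-≢e ℓ x) ⟩
      ∑ (upTo (suc n)) (λ p → leafAt p * X) + term e   ≡⟨ cong₂ _+_ (∑-*ʳ X (upTo (suc n)) leafAt) (counted-∷ʳ-e ℓ x) ⟩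
      ∑ (upTo (suc n)) leafAt * X + a * 𝟙 (suc n ≟ x)  ≡⟨ cong (λ k → ∑ (upTo (suc n)) leafAt * X + a * k) (𝟙-no (suc n ≟ x) (x≢ ∘ sym)) ⟩
      ∑ (upTo (suc n)) leafAt * X + a * 0              ≡⟨ cong (∑ (upTo (suc n)) leafAt * X +_) (*-zeroʳ a) ⟩
      ∑ (upTo (suc n)) leafAt * X + 0                  ≡⟨ +-identityʳ _ ⟩
      ∑ (upTo (suc n)) leafAt * X                      ∎
    solve : ∀ l M a b x → (l *ℤ a +ℤ (M - l) *ℤ b) *ℤ x - a *ℤ x ≡ ((l - 1ℤ) *ℤ a +ℤ (M - l) *ℤ b) *ℤ x
    solve = ℤ-Solver.solve-∀

  counted-∷ʳ-new : (ℓ : ℤ) → ∑ (upTo (suc n)) (λ p → counted (suc (suc n)) ℓ (suc n) (t ∷ʳ p)) ≡ 𝟙 (ℤ.+ L ℤ.≟ ℓ)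
  counted-∷ʳ-new ℓ = begin
    ∑ (upTo (suc n)) term                           ≡⟨ +-identityʳ _ ⟨
    ∑ (upTo (suc n)) term + 0                       ≡⟨ ∑-upTo-exchange (suc n) e e<suc-n term≡0 ⟩
    ∑ (upTo (suc n)) (λ _ → 0) + term e             ≡⟨ cong₂ _+_ (∑-zero (upTo (suc n))) (counted-∷ʳ-e ℓ (suc n)) ⟩
    𝟙 (ℤ.+ L ℤ.≟ ℓ) * 𝟙 (suc n ≟ suc n)             ≡⟨ cong (𝟙 (ℤ.+ L ℤ.≟ ℓ) *_) (𝟙-yes (suc n ≟ suc n) refl) ⟩
    𝟙 (ℤ.+ L ℤ.≟ ℓ) * 1                             ≡⟨ *-identityʳ _ ⟩
    𝟙 (ℤ.+ L ℤ.≟ ℓ)                                 ∎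
    where
    open ≡-Reasoning
    term : ℕ → ℕ
    term p = counted (suc (suc n)) ℓ (suc n) (t ∷ʳ p)
    term≡0 : {p : ℕ} → p < suc n → p ≢ e → term p ≡ 0
    term≡0 {p} p< p≢e = trans (counted-∷ʳ-≢e ℓ (suc n) p< p≢e)
      (trans (cong (leafAt *_) (𝟙-no (e ≟ suc n) (<⇒≢ e<suc-n))) (*-zeroʳ leafAt))
      where
      leafAt : ℕ
      leafAt = 𝟙 (ℤ.+ leaves (suc (suc n)) (t ∷ʳ p) ℤ.≟ ℓ)

  spEnd-unique : ∑ (upTo n) (λ j → 𝟙 (e ≟ suc j)) ≡ 1
  spEnd-unique with e | spEnd≢0 valid t≥1 | spEnd≤ valid
  ... | zero   | e≢0 | _   = ⊥-elim (e≢0 refl)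
  ... | suc e′ | _   | e≤n = ∑-upTo-𝟙≟ n e′ e≤n

Rℤ : ℕ → ℕ → ℤ → ℤ
Rℤ N x ℓ = ℤ.+ R N ℓ x

∑-RecTrees-suc : (n : ℕ) (F : List ℕ → ℕ) →
  ∑ (RecTrees (suc (suc n))) F ≡ ∑ (RecTrees (suc n)) (λ t → ∑ (upTo (suc n)) (λ p → F (t ∷ʳ p)))
∑-RecTrees-suc n F = trans (∑-↭ F (RecTrees-suc↭ n)) (∑-cartesianProductWith _∷ʳ_ (RecTrees (suc n)) (upTo (suc n)) F)

Rℤ-attach : (n : ℕ) → 1 ≤ n → {x : ℕ} → x ≢ suc n → (ℓ : ℤ) → Rℤ (suc (suc n)) x ℓ ≡ attach (suc (suc n)) (Rℤ (suc n) x) ℓ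
Rℤ-attach n n≥1 {x} x≢ ℓ = begin
  ℤ.+ R (suc (suc n)) ℓ x
    ≡⟨ cong ℤ.+_ (trans (R≡∑counted (suc (suc n)) ℓ x) (∑-RecTrees-suc n (counted (suc (suc n)) ℓ x))) ⟩
  ℤ.+ ∑ (RecTrees (suc n)) (λ t → ∑ (upTo (suc n)) (λ p → counted (suc (suc n)) ℓ x (t ∷ʳ p)))
    ≡⟨ attach-∑ (suc (suc n)) (RecTrees (suc n)) {g = λ l → counted (suc n) l x} ℓ perTree ⟩
  attach (suc (suc n)) (λ l → ℤ.+ ∑ (RecTrees (suc n)) (counted (suc n) l x)) ℓ
    ≡⟨ attach-cong (suc (suc n)) (λ l → cong ℤ.+_ (R≡∑counted (suc n) l x)) ℓ ⟨
  attach (suc (suc n)) (Rℤ (suc n) x) ℓ ∎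
  where
  open ≡-Reasoning
  perTree : {t : List ℕ} → t ∈ RecTrees (suc n) →
    ℤ.+ ∑ (upTo (suc n)) (λ p → counted (suc (suc n)) ℓ x (t ∷ʳ p)) ≡ attach (suc (suc n)) (λ l → ℤ.+ counted (suc n) l x t) ℓ
  perTree t∈ with ∈-RecTrees⁻ n t∈
  ... | refl , valid = Attaching.counted-∷ʳ valid n≥1 ℓ x≢

R-at-newest : (n : ℕ) → 1 ≤ n → (ℓ : ℤ) → R (suc (suc n)) ℓ (suc n) ≡ ∑ (upTo n) (λ j → R (suc n) ℓ (suc j))
R-at-newest n n≥1 ℓ = begin
  R (suc (suc n)) ℓ (suc n)
    ≡⟨ trans (R≡∑counted (suc (suc n)) ℓ (suc n)) (∑-RecTrees-suc n (counted (suc (suc n)) ℓ (suc n))) ⟩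
  ∑ (RecTrees (suc n)) (λ t → ∑ (upTo (suc n)) (λ p → counted (suc (suc n)) ℓ (suc n) (t ∷ʳ p)))
    ≡⟨ ∑-cong (RecTrees (suc n)) perTree ⟩
  ∑ (RecTrees (suc n)) (λ t → ∑ (upTo n) (λ j → counted (suc n) ℓ (suc j) t))
    ≡⟨ ∑-swap (RecTrees (suc n)) (upTo n) (λ t j → counted (suc n) ℓ (suc j) t) ⟩
  ∑ (upTo n) (λ j → ∑ (RecTrees (suc n)) (counted (suc n) ℓ (suc j)))
    ≡⟨ ∑-cong (upTo n) (λ {j} _ → R≡∑counted (suc n) ℓ (suc j)) ⟨
  ∑ (upTo n) (λ j → R (suc n) ℓ (suc j)) ∎
  where
  open ≡-Reasoning
  perTree : {t : List ℕ} → t ∈ RecTrees (suc n) →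
    ∑ (upTo (suc n)) (λ p → counted (suc (suc n)) ℓ (suc n) (t ∷ʳ p)) ≡ ∑ (upTo n) (λ j → counted (suc n) ℓ (suc j) t)
  perTree {t} t∈ with ∈-RecTrees⁻ n t∈
  ... | refl , valid = begin
    ∑ (upTo (suc n)) (λ p → counted (suc (suc n)) ℓ (suc n) (t ∷ʳ p))  ≡⟨ counted-∷ʳ-new ℓ ⟩
    𝟙 (ℤ.+ L ℤ.≟ ℓ)                                                     ≡⟨ *-identityʳ _ ⟨
    𝟙 (ℤ.+ L ℤ.≟ ℓ) * 1                                                 ≡⟨ cong (𝟙 (ℤ.+ L ℤ.≟ ℓ) *_) spEnd-unique ⟨
    𝟙 (ℤ.+ L ℤ.≟ ℓ) * ∑ (upTo n) (λ j → 𝟙 (e ≟ suc j))                  ≡⟨ ∑-*ˡ (𝟙 (ℤ.+ L ℤ.≟ ℓ)) (upTo n) _ ⟨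
    ∑ (upTo n) (λ j → 𝟙 (ℤ.+ L ℤ.≟ ℓ) * 𝟙 (e ≟ suc j))                  ≡⟨ ∑-cong (upTo n) (λ {j} _ → 𝟙-×-dec (ℤ.+ L ℤ.≟ ℓ) (e ≟ suc j)) ⟨
    ∑ (upTo n) (λ j → counted (suc n) ℓ (suc j) t)                      ∎
    where open Attaching valid n≥1 using (L; e; counted-∷ʳ-new; spEnd-unique)

-- The recurrence in x

-- The two trees on three vertices both have two leaves; their paths end at 1 and at 2.
R₃-1≡R₃-2 : (ℓ : ℤ) → R 3 ℓ 1 ≡ R 3 ℓ 2
R₃-1≡R₃-2 ℤ.-[1+ _ ]          = refl
R₃-1≡R₃-2 (ℤ.+ 0)             = refl
R₃-1≡R₃-2 (ℤ.+ 1)             = refl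
R₃-1≡R₃-2 (ℤ.+ 2)             = refl
R₃-1≡R₃-2 (ℤ.+ suc (suc (suc _))) = refl

R-1≡R-2 : (n : ℕ) → 1 ≤ n → (ℓ : ℤ) → R (suc (suc n)) ℓ 1 ≡ R (suc (suc n)) ℓ 2
R-1≡R-2 1               _ ℓ = R₃-1≡R₃-2 ℓ
R-1≡R-2 (suc (suc n))   _ ℓ = ℤ.+-injective (begin
  Rℤ (4 + n) 1 ℓ                  ≡⟨ Rℤ-attach (suc (suc n)) (s≤s z≤n) (λ ()) ℓ ⟩
  attach (4 + n) (Rℤ (3 + n) 1) ℓ ≡⟨ attach-cong (4 + n) (λ l → cong ℤ.+_ (R-1≡R-2 (suc n) (s≤s z≤n) l)) ℓ ⟩
  attach (4 + n) (Rℤ (3 + n) 2) ℓ ≡⟨ Rℤ-attach (suc (suc n)) (s≤s z≤n) (λ ()) ℓ ⟨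
  Rℤ (4 + n) 2 ℓ                  ∎)
  where open ≡-Reasoning

Rℤ-at-newest : (n : ℕ) → 1 ≤ n → (ℓ : ℤ) →
  Rℤ (suc (suc (suc n))) (suc (suc n)) ℓ ≡ attach (suc (suc n)) (Rℤ (suc (suc n)) (suc n)) ℓ +ℤ Rℤ (suc (suc n)) (suc n) ℓ
Rℤ-at-newest n n≥1 ℓ = begin
  ℤ.+ R (3 + n) ℓ (2 + n)                                      ≡⟨ cong ℤ.+_ (R-at-newest (suc n) (s≤s z≤n) ℓ) ⟩
  ℤ.+ ∑ (upTo (suc n)) (λ j → R (2 + n) ℓ (suc j))             ≡⟨ cong ℤ.+_ (∑-upTo-∷ʳ n (λ j → R (2 + n) ℓ (suc j))) ⟩
  ℤ.+ (∑ (upTo n) (λ j → R (2 + n) ℓ (suc j)) + R (2 + n) ℓ (suc n))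
                                                                ≡⟨ ℤ.pos-+ (∑ (upTo n) (λ j → R (2 + n) ℓ (suc j))) _ ⟩
  ℤ.+ ∑ (upTo n) (λ j → R (2 + n) ℓ (suc j)) +ℤ Rℤ (2 + n) (suc n) ℓ
                                                                ≡⟨ cong (_+ℤ Rℤ (2 + n) (suc n) ℓ) (attach-∑ (2 + n) (upTo n) {g = λ l j → R (suc n) l (suc j)} ℓ
                                                                     (λ j∈ → Rℤ-attach n n≥1 (<⇒≢ (s<s (∈-upTo⁻ j∈))) ℓ)) ⟩
  attach (2 + n) (λ l → ℤ.+ ∑ (upTo n) (λ j → R (suc n) l (suc j))) ℓ +ℤ Rℤ (2 + n) (suc n) ℓ
                                                                ≡⟨ cong (_+ℤ Rℤ (2 + n) (suc n) ℓ) (attach-cong (2 + n) (λ l → cong ℤ.+_ (R-at-newest n n≥1 l)) ℓ) ⟨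
  attach (2 + n) (Rℤ (2 + n) (suc n)) ℓ +ℤ Rℤ (2 + n) (suc n) ℓ ∎
  where open ≡-Reasoning

Rℤ-difference : (n : ℕ) {x : ℕ} → 2 ≤ x → x ≤ n → (ℓ : ℤ) →
  Rℤ (suc (suc n)) x ℓ - Rℤ (suc (suc n)) (suc x) ℓ ≡ Δ (Rℤ (suc n) x) ℓ
Rℤ-difference zero    (s≤s _) ()
Rℤ-difference (suc n) {x} x≥2 x≤n ℓ with x ≟ suc n
... | yes refl = begin
  Rℤ (3 + n) (suc n) ℓ - Rℤ (3 + n) (2 + n) ℓ
    ≡⟨ cong₂ _-_ (Rℤ-attach (suc n) (s≤s z≤n) (<⇒≢ (n<1+n (suc n))) ℓ) (Rℤ-at-newest n n≥1 ℓ) ⟩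
  attach (3 + n) E ℓ - (attach (2 + n) E ℓ +ℤ E ℓ)
    ≡⟨ cong (_- (attach (2 + n) E ℓ +ℤ E ℓ)) (attach-suc (2 + n) E ℓ) ⟩
  attach (2 + n) E ℓ +ℤ E (ℓ - 1ℤ) - (attach (2 + n) E ℓ +ℤ E ℓ)
    ≡⟨ solve (attach (2 + n) E ℓ) (E (ℓ - 1ℤ)) (E ℓ) ⟩
  Δ E ℓ ∎
  where
  open ≡-Reasoning
  E : ℤ → ℤ
  E = Rℤ (2 + n) (suc n)
  n≥1 : 1 ≤ n
  n≥1 = ≤-pred x≥2
  solve : ∀ a b c → a +ℤ b - (a +ℤ c) ≡ b - c
  solve = ℤ-Solver.solve-∀
... | no x≢1+n = begin
  Rℤ (3 + n) x ℓ - Rℤ (3 + n) (suc x) ℓ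
    ≡⟨ cong₂ _-_ (Rℤ-attach (suc n) (s≤s z≤n) (<⇒≢ (s≤s x≤n)) ℓ)
                 (Rℤ-attach (suc n) (s≤s z≤n) (x≢1+n ∘ suc-injective) ℓ) ⟩
  attach (3 + n) (Rℤ (2 + n) x) ℓ - attach (3 + n) (Rℤ (2 + n) (suc x)) ℓ
    ≡⟨ attach-- (3 + n) (Rℤ (2 + n) x) (Rℤ (2 + n) (suc x)) ℓ ⟩
  attach (3 + n) (λ l → Rℤ (2 + n) x l - Rℤ (2 + n) (suc x) l) ℓ
    ≡⟨ attach-cong (3 + n) (Rℤ-difference n x≥2 x≤n′) ℓ ⟩
  attach (3 + n) (Δ (Rℤ (suc n) x)) ℓ
    ≡⟨ attach-Δ (2 + n) (Rℤ (suc n) x) ℓ ⟩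
  Δ (attach (2 + n) (Rℤ (suc n) x)) ℓ
    ≡⟨ cong₂ _-_ (Rℤ-attach n n≥1 x≢1+n (ℓ - 1ℤ)) (Rℤ-attach n n≥1 x≢1+n ℓ) ⟨
  Δ (Rℤ (2 + n) x) ℓ ∎
  where
  open ≡-Reasoning
  x≤n′ : x ≤ n
  x≤n′ = ≤-pred (≤∧≢⇒< x≤n x≢1+n)
  n≥1 : 1 ≤ n
  n≥1 = ≤-trans (≤-trans (n≤1+n 1) x≥2) x≤n′

R-difference : (n : ℕ) {x : ℕ} → 2 ≤ x → x ≤ n → (ℓ : ℤ) →
  R (suc (suc n)) ℓ x + R (suc n) ℓ x ≡ R (suc (suc n)) ℓ (suc x) + R (suc n) (ℓ - 1ℤ) x
R-difference n {x} x≥2 x≤n ℓ = ℤ.+-injective (begin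
  ℤ.+ (a + d)        ≡⟨ ℤ.pos-+ a d ⟩
  ℤ.+ a +ℤ ℤ.+ d     ≡⟨ solve (ℤ.+ a) (ℤ.+ b) (ℤ.+ d) ⟩
  ℤ.+ b +ℤ (ℤ.+ a - ℤ.+ b +ℤ ℤ.+ d) ≡⟨ cong (λ k → ℤ.+ b +ℤ (k +ℤ ℤ.+ d)) (Rℤ-difference n x≥2 x≤n ℓ) ⟩
  ℤ.+ b +ℤ (ℤ.+ c - ℤ.+ d +ℤ ℤ.+ d) ≡⟨ cong (ℤ.+ b +ℤ_) (solve′ (ℤ.+ c) (ℤ.+ d)) ⟩
  ℤ.+ b +ℤ ℤ.+ c     ≡⟨ ℤ.pos-+ b c ⟨
  ℤ.+ (b + c)        ∎)
  where
  open ≡-Reasoning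
  a b c d : ℕ
  a = R (suc (suc n)) ℓ x
  b = R (suc (suc n)) ℓ (suc x)
  c = R (suc n) (ℓ - 1ℤ) x
  d = R (suc n) ℓ x
  solve : ∀ a b d → a +ℤ d ≡ b +ℤ (a - b +ℤ d)
  solve = ℤ-Solver.solve-∀
  solve′ : ∀ c d → c - d +ℤ d ≡ c
  solve′ = ℤ-Solver.solve-∀

telescope : (F g h : ℕ → ℕ) (x k : ℕ) → (∀ j → j < k → F (x + j) + h (x + j) ≡ F (suc (x + j)) + g (x + j)) →
  F x + ∑ (upTo k) (λ j → h (x + j)) ≡ F (x + k) + ∑ (upTo k) (λ j → g (x + j))
telescope F g h x zero    _    = cong (λ y → F y + 0) (sym (+-identityʳ x))
telescope F g h x (suc k) step = begin
  F x + ∑ (upTo (suc k)) (h ∘ (x +_))                ≡⟨ cong (F x +_) (∑-upTo-∷ʳ k (h ∘ (x +_))) ⟩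
  F x + (∑ (upTo k) (h ∘ (x +_)) + h (x + k))        ≡⟨ +-assoc (F x) _ _ ⟨
  F x + ∑ (upTo k) (h ∘ (x +_)) + h (x + k)          ≡⟨ cong (_+ h (x + k)) (telescope F g h x k (λ j j<k → step j (m<n⇒m<1+n j<k))) ⟩
  F (x + k) + ∑ (upTo k) (g ∘ (x +_)) + h (x + k)    ≡⟨ +-right-comm (F (x + k)) _ _ ⟩
  F (x + k) + h (x + k) + ∑ (upTo k) (g ∘ (x +_))    ≡⟨ cong (_+ ∑ (upTo k) (g ∘ (x +_))) (step k ≤-refl) ⟩
  F (suc (x + k)) + g (x + k) + ∑ (upTo k) (g ∘ (x +_))  ≡⟨ +-right-comm (F (suc (x + k))) _ _ ⟩
  F (suc (x + k)) + ∑ (upTo k) (g ∘ (x +_)) + g (x + k)  ≡⟨ +-assoc (F (suc (x + k))) _ _ ⟩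
  F (suc (x + k)) + (∑ (upTo k) (g ∘ (x +_)) + g (x + k)) ≡⟨ cong₂ (λ y s → F y + s) (sym (+-suc x k)) (sym (∑-upTo-∷ʳ k (g ∘ (x +_)))) ⟩
  F (x + suc k) + ∑ (upTo (suc k)) (g ∘ (x +_))      ∎
  where open ≡-Reasoning

R-closed-form : (n : ℕ) → 1 ≤ n → (ℓ : ℤ) (x : ℕ) → 2 ≤ x → x ≤ suc n →
  R (suc (suc n)) ℓ x ≡ sumRange x n (λ i → R (suc n) (ℓ - 1ℤ) i) + sumRange 1 (x ∸ 1) (λ i → R (suc n) ℓ i)
R-closed-form n n≥1 ℓ (suc x) (s≤s x≥1) (s≤s x≤n) = +-cancelʳ-≡ H _ _ (begin
  F (suc x) + H                                   ≡⟨ telescope F g h (suc x) k step ⟩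
  F (suc x + k) + G                               ≡⟨ cong (λ y → F (suc y) + G) x+k≡n ⟩
  F (suc n) + G                                   ≡⟨ cong (_+ G) (R-at-newest n n≥1 ℓ) ⟩
  ∑ (upTo n) (h ∘ suc) + G                        ≡⟨ cong (λ m → ∑ (upTo m) (h ∘ suc) + G) x+k≡n ⟨
  ∑ (upTo (x + k)) (h ∘ suc) + G                  ≡⟨ cong (_+ G) (∑-upTo-+ x k (h ∘ suc)) ⟩
  ∑ (upTo x) (h ∘ suc) + H + G                    ≡⟨ +-right-comm (∑ (upTo x) (h ∘ suc)) H G ⟩
  ∑ (upTo x) (h ∘ suc) + G + H                    ≡⟨ cong (_+ H) (+-comm (∑ (upTo x) (h ∘ suc)) G) ⟩
  G + ∑ (upTo x) (h ∘ suc) + H                    ≡⟨ cong₂ (λ a b → a + b + H) (sum-map≡∑ (upTo k) (g ∘ (suc x +_))) (sum-map≡∑ (upTo x) (h ∘ suc)) ⟨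
  sumRange (suc x) n g + sumRange 1 x h + H       ∎)
  where
  open ≡-Reasoning
  F g h : ℕ → ℕ
  F = R (suc (suc n)) ℓ
  g = R (suc n) (ℓ - 1ℤ)
  h = R (suc n) ℓ
  k G H : ℕ
  k = n ∸ x
  G = ∑ (upTo k) (g ∘ (suc x +_))
  H = ∑ (upTo k) (h ∘ (suc x +_))
  x+k≡n : x + k ≡ n
  x+k≡n = m+[n∸m]≡n x≤n
  step : ∀ j → j < k → F (suc x + j) + h (suc x + j) ≡ F (suc (suc x + j)) + g (suc x + j)
  step j j<k = R-difference n (s≤s (≤-trans x≥1 (m≤m+n x j))) (subst (x + j <_) x+k≡n (+-monoʳ-< x j<k)) ℓ

theorem7p6 : (N : ℕ) (ℓ : ℤ) (x : ℕ) → 2 < N → 1 ≤ x → x ≤ N ∸ 1 →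
    R N ℓ x ≡ sumRange (x ⊔ 2) (N ∸ 2) (λ i → R (N ∸ 1) (ℓ - 1ℤ) i)
              + sumRange 1 ((x ∸ 1) ⊔ 1) (λ i → R (N ∸ 1) ℓ i)
-- For x = 1 the right-hand side is literally the one for x = 2.
theorem7p6 _ ℓ 1 (s≤s (s≤s (s≤s {n = m} _))) _ _ =
  trans (R-1≡R-2 (suc m) (s≤s z≤n) ℓ) (R-closed-form (suc m) (s≤s z≤n) ℓ 2 ≤-refl (s≤s (s≤s z≤n)))
theorem7p6 _ ℓ (suc (suc x)) (s≤s (s≤s (s≤s {n = m} _))) _ x≤ rewrite ⊔-identityʳ x =
  R-closed-form (suc m) (s≤s z≤n) ℓ (suc (suc x)) (s≤s (s≤s z≤n)) x≤
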